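{- Fix positive integers $p,q$. Let $\boldsymbol u=(u_0,\dots,u_{p-1})$ and $\boldsymbol v=(v_0,\dots,v_{q-1})$ each be a vector of one of the forms $(a,a,\dots,a)$, $(a,a,\dots,a,2a)$, or $(a,a+b,a+2b,\dots,a+(n-1)b)$ (with $a,b\ge1$ and $n$ the length of the vector). Let $G_1$ and $G_2$ be graphs (with root $0$, $G_1$ having $p$ non-root vertices and $G_2$ having $q$ non-root vertices) such that $\mathcal{PF}(\boldsymbol u)=\mathcal{PF}(G_1)$ and $\mathcal{PF}(\boldsymbol v)=\mathcal{PF}(G_2)$. If $\boldsymbol U=\{(u_i,v_j):0\le i<p,\ 0\le j<q\}$ (i.e., $u_{i,j}=u_i$, $v_{i,j}=v_j$), then $\mathcal{PF}^{(2)}_{p,q}(\boldsymbol U)=\mathcal{PF}(G_1\mathbin{\dot\cup}G_2)$, where $G_1\mathbin{\dot\cup}G_2$ is obtained from the disjoint union of $G_1$ and $G_2$ by merging the two roots into a single new root.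
   Context: A graph is a finite, connected, undirected, loopless multigraph with distinguished root vertex $0$ and other vertices $1,\dots,n$, viewed as a simple graph with edge-weight function $wt$ counting parallel edges. For $U\subseteq V(G)$ and $i\in U$, $d_U(i)=\sum_{j\notin U}wt(\{i,j\})$. A $G$-parking function is $(b_1,\dots,b_n)\in\mathbb{N}^n$ such that every non-empty $U\subseteq\{1,\dots,n\}$ contains $i$ with $b_i<d_U(i)$; $\mathcal{PF}(G)$ is their set. For a non-decreasing sequence $\boldsymbol u=(u_1,\dots,u_n)$ of positive integers, a $\boldsymbol u$-parking function is $\boldsymbol a\in\mathbb{N}^n$ whose non-decreasing rearrangement $a_{(1)}\le\dots\le a_{(n)}$ satisfies $a_{(i)}<u_i$ for all $i$; $\mathcal{PF}(\boldsymbol u)$ is their set. In $G_1\mathbin{\dot\cup}G_2$ the non-root vertices of $G_1$ are labelled $1,\dots,p$ (in their original order) and those of $G_2$ are labelled $p+1,\dots,p+q$, so a $G_1\mathbin{\dot\cup}G_2$-parking function $(b_1,\dots,b_{p+q})$ is identified with the pair $((b_1,\dots,b_p),(b_{p+1},\dots,b_{p+q}))$. Two-dimensional $\boldsymbol U$-parking functions: given weights $u_{i,j},v_{i,j}\in\mathbb{N}$ that are non-decreasing in $(i,j)$ for the componentwise order, consider lattice paths from $(0,0)$ to $(p,q)$ with unit east steps $E$ and north steps $N$; an $E$-step from $(i,j)$ to $(i+1,j)$ has weight $u_{i,j}$ and an $N$-step from $(i,j)$ to $(i,j+1)$ has weight $v_{i,j}$. A pair $(\boldsymbol a,\boldsymbol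 b)$ with $\boldsymbol a\in\mathbb{N}^p$, $\boldsymbol b\in\mathbb{N}^q$ is bounded by such a path $P$ if, whenever the $r$-th step of $P$ is its $i$-th $E$-step, $a_{(i)}$ is less than that step's weight, and whenever it is its $j$-th $N$-step, $b_{(j)}$ is less than that step's weight (where $a_{(\cdot)},b_{(\cdot)}$ are the order statistics). $\mathcal{PF}^{(2)}_{p,q}(\boldsymbol U)$ is the set of pairs bounded by at least one such path. -}

module Defs where

open import Data.Nat using (ℕ; zero; suc; _+_; _*_; _≤_; _<_; _<?_; _≡ᵇ_)
open import Data.Fin using (Fin; zero; suc; toℕ; fromℕ<; splitAt; _↑ˡ_; _↑ʳ_; join)
open import Data.Fin.Properties using (splitAt-↑ˡ; splitAt-↑ʳ; join-splitAt)
open import Data.Fin.Subset using (Subset; inside; outside; _∈_; Nonempty)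
open import Data.Fin.Permutation using (Permutation′; _⟨$⟩ʳ_)
open import Data.Vec using (Vec; _∷_; lookup)
open import Data.Bool using (if_then_else_)
open import Data.List using (List; []; _∷_; map)
open import Data.Product using (Σ; ∃; _×_; _,_)
open import Data.Sum using (_⊎_; inj₁; inj₂; [_,_]′)
open import Data.Unit using (⊤)
open import Data.Empty using (⊥)
open import Relation.Nullary using (yes; no)
open import Relation.Binary.PropositionalEquality using (_≡_; refl; sym; trans; cong; subst; cong₂)

ΣFin : (n : ℕ) → (Fin n → ℕ) → ℕ
ΣFin zero    f = 0
ΣFin (suc n) f = f zero + ΣFin n (λ i → f (suc i))

-- Graphs: vertices Fin (suc n), root = zero, non-root vertices suc i
-- (i : Fin n) correspond to 1,…,n. Edge multiplicities given by wt.

data Reach {n : ℕ} (wt : Fin (suc n) → Fin (suc n) → ℕ) : Fin (suc n) → Set where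
  root : Reach wt zero
  step : ∀ {i j} → Reach wt i → 0 < wt i j → Reach wt j

record Graph (n : ℕ) : Set where
  field
    wt        : Fin (suc n) → Fin (suc n) → ℕ
    symmetric : ∀ i j → wt i j ≡ wt j i
    loopless  : ∀ i → wt i i ≡ 0
    connected : ∀ i → Reach wt i

-- d_U(i) = Σ_{j ∉ U} wt(i,j), where U ⊆ {1,…,n} (the root is never in U).
dU : ∀ {n} → Graph n → Subset n → Fin (suc n) → ℕ
dU {n} G U i =
  ΣFin (suc n) (λ j → if lookup (outside ∷ U) j then 0 else Graph.wt G i j)

-- G-parking functions: b : Fin n → ℕ, b i is the value at vertex suc i.
IsGPF : ∀ {n} → Graph n → (Fin n → ℕ) → Set
IsGPF {n} G b = ∀ (U : Subset n) → Nonempty U →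
  ∃ λ (i : Fin n) → i ∈ U × b i < dU G U (suc i)

-- Order statistics: σ is a sorting permutation of a when a ∘ σ is
-- non-decreasing; then a (σ ⟨$⟩ʳ i) is the (i+1)-th order statistic.

Sorts : ∀ {n} → (Fin n → ℕ) → Permutation′ n → Set
Sorts {n} a σ = ∀ (i j : Fin n) → toℕ i ≤ toℕ j → a (σ ⟨$⟩ʳ i) ≤ a (σ ⟨$⟩ʳ j)

-- u-parking functions (u indexed from 0: a_(i+1) < u_i).
IsUPF : ∀ {n} → (Fin n → ℕ) → (Fin n → ℕ) → Set
IsUPF {n} u a = ∃ λ (σ : Permutation′ n) → Sorts a σ × (∀ i → a (σ ⟨$⟩ʳ i) < u i)

data AdmissibleForm {n : ℕ} (u : Fin n → ℕ) : Set where
  constant   : (a : ℕ) → 1 ≤ a → (∀ i → u i ≡ a) → AdmissibleForm u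
  lastDouble : (a : ℕ) → 1 ≤ a →
               (∀ i → u i ≡ (if suc (toℕ i) ≡ᵇ n then 2 * a else a)) →
               AdmissibleForm u
  arithmetic : (a b : ℕ) → 1 ≤ a → 1 ≤ b → (∀ i → u i ≡ a + toℕ i * b) →
               AdmissibleForm u

-- Two-dimensional U-parking functions.
-- Lattice paths from (0,0) to (p,q) are lists of steps; an E step from
-- (i,j) has weight uw i j, an N step from (i,j) has weight vw i j.

data Step : Set where
  E N : Step

-- Bounded uw vw as bs i j P : starting at (i,j), the path P consumes
-- the remaining order statistics as (for E steps) and bs (for N steps)
-- in order; each must be below the weight of the corresponding step.
-- Both lists must be used up exactly when P ends, so P has exactly
-- length as E-steps and length bs N-steps.
Bounded : (uw vw : ℕ → ℕ → ℕ) → List ℕ → List ℕ → ℕ → ℕ → List Step → Set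
Bounded uw vw []       []       i j []      = ⊤
Bounded uw vw (x ∷ as) bs       i j (E ∷ P) = x < uw i j × Bounded uw vw as bs (suc i) j P
Bounded uw vw as       (y ∷ bs) i j (N ∷ P) = y < vw i j × Bounded uw vw as bs i (suc j) P
Bounded uw vw _        _        _ _ _       = ⊥

allFinL : (n : ℕ) → List (Fin n)
allFinL zero    = []
allFinL (suc n) = zero ∷ map suc (allFinL n)

orderStats : ∀ {n} → (Fin n → ℕ) → Permutation′ n → List ℕ
orderStats {n} a σ = map (λ i → a (σ ⟨$⟩ʳ i)) (allFinL n)

IsPF2 : ∀ {p q} → (uw vw : ℕ → ℕ → ℕ) → (Fin p → ℕ) → (Fin q → ℕ) → Set
IsPF2 {p} {q} uw vw a b =
  Σ (Permutation′ p) λ σ → Σ (Permutation′ q) λ τ →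
    Sorts a σ × Sorts b τ ×
    ∃ λ (P : List Step) → Bounded uw vw (orderStats a σ) (orderStats b τ) 0 0 P

-- extend a Fin n-indexed vector to ℕ (values outside range are never used)
extend : ∀ {n} → (Fin n → ℕ) → ℕ → ℕ
extend {n} u i with i <? n
... | yes h = u (fromℕ< h)
... | no  _ = 0

-- G₁ ∪̇ G₂ with roots merged. Vertex suc k (k : Fin (p + q)) is the
-- vertex suc x of G₁ if splitAt p k = inj₁ x, and suc y of G₂ if inj₂ y.

data Part (p q : ℕ) : Set where
  rt : Part p q
  g1 : Fin p → Part p q
  g2 : Fin q → Part p q

part : ∀ {p q} → Fin (suc (p + q)) → Part p q
part zero    = rt
part {p} (suc k) = [ g1 , g2 ]′ (splitAt p k)

wtPart : ∀ {p q} → Graph p → Graph q → Part p q → Part p q → ℕ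
wtPart G₁ G₂ rt     rt     = 0
wtPart G₁ G₂ rt     (g1 y) = Graph.wt G₁ zero (suc y)
wtPart G₁ G₂ rt     (g2 y) = Graph.wt G₂ zero (suc y)
wtPart G₁ G₂ (g1 x) rt     = Graph.wt G₁ (suc x) zero
wtPart G₁ G₂ (g1 x) (g1 y) = Graph.wt G₁ (suc x) (suc y)
wtPart G₁ G₂ (g1 x) (g2 y) = 0
wtPart G₁ G₂ (g2 x) rt     = Graph.wt G₂ (suc x) zero
wtPart G₁ G₂ (g2 x) (g1 y) = 0
wtPart G₁ G₂ (g2 x) (g2 y) = Graph.wt G₂ (suc x) (suc y)

wtU : ∀ {p q} → Graph p → Graph q → Fin (suc (p + q)) → Fin (suc (p + q)) → ℕ
wtU G₁ G₂ i j = wtPart G₁ G₂ (part i) (part j)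

private
  unPart : ∀ {p q} → Part p q → Fin (suc (p + q))
  unPart         rt     = zero
  unPart {q = q} (g1 x) = suc (x ↑ˡ q)
  unPart {p = p} (g2 y) = suc (p ↑ʳ y)

  part-unPart : ∀ {p q} (π : Part p q) → part (unPart π) ≡ π
  part-unPart         rt     = refl
  part-unPart {p} {q} (g1 x) = cong [ g1 , g2 ]′ (splitAt-↑ˡ p x q)
  part-unPart {p} {q} (g2 y) = cong [ g1 , g2 ]′ (splitAt-↑ʳ p q y)

  unPart-part : ∀ {p q} (k : Fin (suc (p + q))) → unPart {p} {q} (part k) ≡ k
  unPart-part zero = refl
  unPart-part {p} {q} (suc k) with splitAt p k in eq
  ... | inj₁ x = cong suc (trans (cong (join p q) (sym eq)) (join-splitAt p q k))
  ... | inj₂ y = cong suc (trans (cong (join p q) (sym eq)) (join-splitAt p q k))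

  wtPart-sym : ∀ {p q} (G₁ : Graph p) (G₂ : Graph q) (x y : Part p q) →
               wtPart G₁ G₂ x y ≡ wtPart G₁ G₂ y x
  wtPart-sym G₁ G₂ rt     rt     = refl
  wtPart-sym G₁ G₂ rt     (g1 y) = Graph.symmetric G₁ _ _
  wtPart-sym G₁ G₂ rt     (g2 y) = Graph.symmetric G₂ _ _
  wtPart-sym G₁ G₂ (g1 x) rt     = Graph.symmetric G₁ _ _
  wtPart-sym G₁ G₂ (g1 x) (g1 y) = Graph.symmetric G₁ _ _
  wtPart-sym G₁ G₂ (g1 x) (g2 y) = refl
  wtPart-sym G₁ G₂ (g2 x) rt     = Graph.symmetric G₂ _ _
  wtPart-sym G₁ G₂ (g2 x) (g1 y) = refl
  wtPart-sym G₁ G₂ (g2 x) (g2 y) = Graph.symmetric G₂ _ _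

  wtPart-loop : ∀ {p q} (G₁ : Graph p) (G₂ : Graph q) (x : Part p q) →
                wtPart G₁ G₂ x x ≡ 0
  wtPart-loop G₁ G₂ rt     = refl
  wtPart-loop G₁ G₂ (g1 x) = Graph.loopless G₁ _
  wtPart-loop G₁ G₂ (g2 x) = Graph.loopless G₂ _

  lift1 : ∀ {p q} → Fin (suc p) → Part p q
  lift1 zero    = rt
  lift1 (suc x) = g1 x

  lift2 : ∀ {p q} → Fin (suc q) → Part p q
  lift2 zero    = rt
  lift2 (suc x) = g2 x

  wt-lift1 : ∀ {p q} (G₁ : Graph p) (G₂ : Graph q) (i j : Fin (suc p)) →
             wtPart G₁ G₂ (lift1 i) (lift1 j) ≡ Graph.wt G₁ i j
  wt-lift1 G₁ G₂ zero    zero    = sym (Graph.loopless G₁ zero)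
  wt-lift1 G₁ G₂ zero    (suc j) = refl
  wt-lift1 G₁ G₂ (suc i) zero    = refl
  wt-lift1 G₁ G₂ (suc i) (suc j) = refl

  wt-lift2 : ∀ {p q} (G₁ : Graph p) (G₂ : Graph q) (i j : Fin (suc q)) →
             wtPart G₁ G₂ (lift2 i) (lift2 j) ≡ Graph.wt G₂ i j
  wt-lift2 G₁ G₂ zero    zero    = sym (Graph.loopless G₂ zero)
  wt-lift2 G₁ G₂ zero    (suc j) = refl
  wt-lift2 G₁ G₂ (suc i) zero    = refl
  wt-lift2 G₁ G₂ (suc i) (suc j) = refl

  wtU-unPart : ∀ {p q} (G₁ : Graph p) (G₂ : Graph q) (x y : Part p q) →
               wtU G₁ G₂ (unPart x) (unPart y) ≡ wtPart G₁ G₂ x y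
  wtU-unPart G₁ G₂ x y = cong₂ (wtPart G₁ G₂) (part-unPart x) (part-unPart y)

  reach1 : ∀ {p q} (G₁ : Graph p) (G₂ : Graph q) {v} →
           Reach (Graph.wt G₁) v → Reach (wtU G₁ G₂) (unPart (lift1 v))
  reach1 G₁ G₂ root = root
  reach1 G₁ G₂ (step {i} {j} r h) =
    step (reach1 G₁ G₂ r)
      (subst (0 <_) (sym (trans (wtU-unPart G₁ G₂ (lift1 i) (lift1 j))
                                (wt-lift1 G₁ G₂ i j))) h)

  reach2 : ∀ {p q} (G₁ : Graph p) (G₂ : Graph q) {v} →
           Reach (Graph.wt G₂) v → Reach (wtU G₁ G₂) (unPart (lift2 v))
  reach2 G₁ G₂ root = root
  reach2 G₁ G₂ (step {i} {j} r h) =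
    step (reach2 G₁ G₂ r)
      (subst (0 <_) (sym (trans (wtU-unPart G₁ G₂ (lift2 i) (lift2 j))
                                (wt-lift2 G₁ G₂ i j))) h)

  reachU : ∀ {p q} (G₁ : Graph p) (G₂ : Graph q) (k : Fin (suc (p + q))) →
           Reach (wtU G₁ G₂) k
  reachU {p} {q} G₁ G₂ k = subst (Reach (wtU G₁ G₂)) (unPart-part k) (go (part k))
    where
    go : (π : Part p q) → Reach (wtU G₁ G₂) (unPart π)
    go rt     = root
    go (g1 x) = reach1 G₁ G₂ (Graph.connected G₁ (suc x))
    go (g2 y) = reach2 G₁ G₂ (Graph.connected G₂ (suc y))

_∪̇_ : ∀ {p q} → Graph p → Graph q → Graph (p + q)
G₁ ∪̇ G₂ = record
  { wt        = wtU G₁ G₂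
  ; symmetric = λ i j → wtPart-sym G₁ G₂ (part i) (part j)
  ; loopless  = λ i → wtPart-loop G₁ G₂ (part i)
  ; connected = reachU G₁ G₂
  }

concatF : ∀ {p q} → (Fin p → ℕ) → (Fin q → ℕ) → Fin (p + q) → ℕ
concatF {p} a b k = [ a , b ]′ (splitAt p k)

{-# OPTIONS --safe #-}
module Submission where

-- Because the weights u_{i,j} = u_i and v_{i,j} = v_j do not depend on the
-- other coordinate, a lattice path bounds (a, b) exactly when the E-steps
-- bound a by u and the N-steps bound b by v, so any path works as soon as one
-- does (take E…EN…N): PF²(U) = PF(u) × PF(v). On the graph side, G₁ ∪̇ G₂ has
-- no edges between the two halves, so d_U at a vertex of G₁ only sees U ∩ G₁;
-- a non-empty U meets one half, and conversely a set inside one half tests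
-- that half alone. Hence PF(G₁ ∪̇ G₂) = PF(G₁) × PF(G₂) as well.

open import Defs
open import Data.Nat using (ℕ; zero; suc; _+_; _≤_; _<_; _<?_)
open import Data.Nat.Properties using (+-assoc; +-identityʳ; +-suc)
open import Data.Fin using (Fin; zero; suc; toℕ; splitAt; _↑ˡ_; _↑ʳ_)
open import Data.Fin.Properties using (splitAt-↑ˡ; splitAt-↑ʳ; splitAt⁻¹-↑ˡ; splitAt⁻¹-↑ʳ; toℕ<n; fromℕ<-toℕ)
open import Data.Fin.Subset using (Subset; _∈_; Nonempty; ⊥)
open import Data.Fin.Subset.Properties using (∉⊥)
open import Data.Fin.Permutation using (_⟨$⟩ʳ_)
open import Data.Vec as Vec using (_++_; lookup)
open import Data.Vec.Properties using (lookup-++ˡ; lookup-++ʳ; []=⇒lookup; lookup⇒[]=)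
open import Data.Bool using (if_then_else_)
open import Data.Bool.Properties using (if-eta)
open import Data.List as List using (List; []; _∷_; map)
open import Data.List.Properties using (map-∘)
open import Data.Product using (∃; _×_; _,_)
open import Data.Product.Function.NonDependent.Propositional using (_×-⇔_)
open import Data.Sum as Sum using (_⊎_; inj₁; inj₂; [_,_]′)
open import Data.Unit using (⊤; tt)
open import Data.Empty using (⊥-elim)
open import Function.Base using (_∘_)
open import Function.Bundles using (_⇔_; mk⇔; Equivalence)
open import Function.Properties.Equivalence as ⇔ using ()
open import Function.Related.Propositional using (module EquationalReasoning)
open import Relation.Nullary using (yes; no)
open import Relation.Binary.PropositionalEquality using (_≡_; refl; sym; trans; cong; cong₂; subst; subst₂)

Below : (ℕ → ℕ) → ℕ → List ℕ → Set
Below f i []       = ⊤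
Below f i (x ∷ xs) = x < f i × Below f (suc i) xs

module _ (f g : ℕ → ℕ) where

  private
    SeparablyBounded : List ℕ → List ℕ → ℕ → ℕ → List Step → Set
    SeparablyBounded = Bounded (λ i _ → f i) (λ _ j → g j)

  Bounded-separable⁻ : ∀ xs ys i j P → SeparablyBounded xs ys i j P →
                       Below f i xs × Below g j ys
  Bounded-separable⁻ []       []       i j []      _        = tt , tt
  Bounded-separable⁻ (x ∷ xs) []       i j []      ()
  Bounded-separable⁻ (x ∷ xs) (y ∷ ys) i j []      ()
  Bounded-separable⁻ (x ∷ xs) ys       i j (E ∷ P) (x< , r) =
    let xs< , ys< = Bounded-separable⁻ xs ys (suc i) j P r in (x< , xs<) , ys<
  Bounded-separable⁻ []       (y ∷ ys) i j (N ∷ P) (y< , r) =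
    let xs< , ys< = Bounded-separable⁻ [] ys i (suc j) P r in xs< , (y< , ys<)
  Bounded-separable⁻ (x ∷ xs) (y ∷ ys) i j (N ∷ P) (y< , r) =
    let xs< , ys< = Bounded-separable⁻ (x ∷ xs) ys i (suc j) P r in xs< , (y< , ys<)

  Bounded-separable⁺ : ∀ xs ys i j → Below f i xs → Below g j ys →
                       SeparablyBounded xs ys i j (map (λ _ → E) xs List.++ map (λ _ → N) ys)
  Bounded-separable⁺ (x ∷ xs) ys       i j (x< , xs<) ys<        =
    x< , Bounded-separable⁺ xs ys (suc i) j xs< ys<
  Bounded-separable⁺ []       (y ∷ ys) i j _          (y< , ys<) =
    y< , Bounded-separable⁺ [] ys i (suc j) tt ys<
  Bounded-separable⁺ []       []       i j _          _          = tt

map-allFinL-suc : ∀ n (h : Fin (suc n) → ℕ) →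
                  map h (allFinL (suc n)) ≡ h zero ∷ map (h ∘ suc) (allFinL n)
map-allFinL-suc n h = cong (h zero ∷_) (sym (map-∘ (allFinL n)))

Below-allFinL⁻ : ∀ f n k (h : Fin n → ℕ) → Below f k (map h (allFinL n)) →
                 ∀ i → h i < f (k + toℕ i)
Below-allFinL⁻ f (suc n) k h below i
  with h0< , rest< ← subst (Below f k) (map-allFinL-suc n h) below
  with i
... | zero  = subst (λ m → h zero < f m) (sym (+-identityʳ k)) h0<
... | suc i = subst (λ m → h (suc i) < f m) (sym (+-suc k (toℕ i)))
                (Below-allFinL⁻ f n (suc k) (h ∘ suc) rest< i)

Below-allFinL⁺ : ∀ f n k (h : Fin n → ℕ) → (∀ i → h i < f (k + toℕ i)) →
                 Below f k (map h (allFinL n))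
Below-allFinL⁺ f zero    k h _  = tt
Below-allFinL⁺ f (suc n) k h h< = subst (Below f k) (sym (map-allFinL-suc n h))
  ( subst (λ m → h zero < f m) (+-identityʳ k) (h< zero)
  , Below-allFinL⁺ f n (suc k) (h ∘ suc)
      (λ i → subst (λ m → h (suc i) < f m) (+-suc k (toℕ i)) (h< (suc i))))

Below-orderStats : ∀ f {n} (a : Fin n → ℕ) σ →
                   Below f 0 (orderStats a σ) ⇔ (∀ i → a (σ ⟨$⟩ʳ i) < f (toℕ i))
Below-orderStats f {n} a σ =
  mk⇔ (Below-allFinL⁻ f n 0 _) (Below-allFinL⁺ f n 0 _)

IsPF2-separable : ∀ {p q} (f g : ℕ → ℕ) (a : Fin p → ℕ) (b : Fin q → ℕ) →
                  IsPF2 (λ i _ → f i) (λ _ j → g j) a b ⇔ (IsUPF (f ∘ toℕ) a × IsUPF (g ∘ toℕ) b)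
IsPF2-separable f g a b = mk⇔ to from
  where
  to : IsPF2 (λ i _ → f i) (λ _ j → g j) a b → IsUPF (f ∘ toℕ) a × IsUPF (g ∘ toℕ) b
  to (σ , τ , σ-sorts , τ-sorts , P , bounded) =
    let a< , b< = Bounded-separable⁻ f g _ _ 0 0 P bounded
    in (σ , σ-sorts , Equivalence.to (Below-orderStats f a σ) a<)
     , (τ , τ-sorts , Equivalence.to (Below-orderStats g b τ) b<)

  from : IsUPF (f ∘ toℕ) a × IsUPF (g ∘ toℕ) b → IsPF2 (λ i _ → f i) (λ _ j → g j) a b
  from ((σ , σ-sorts , a<) , (τ , τ-sorts , b<)) =
    σ , τ , σ-sorts , τ-sorts , _ ,
    Bounded-separable⁺ f g _ _ 0 0 (Equivalence.from (Below-orderStats f a σ) a<)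
                                   (Equivalence.from (Below-orderStats g b τ) b<)

IsUPF-cong : ∀ {n} {u u′ : Fin n → ℕ} → (∀ i → u i ≡ u′ i) → ∀ a → IsUPF u a ⇔ IsUPF u′ a
IsUPF-cong u≗u′ a = mk⇔
  (λ (σ , sorts , a<) → σ , sorts , λ i → subst (_ <_) (u≗u′ i) (a< i))
  (λ (σ , sorts , a<) → σ , sorts , λ i → subst (_ <_) (sym (u≗u′ i)) (a< i))

extend-toℕ : ∀ {n} (u : Fin n → ℕ) i → extend u (toℕ i) ≡ u i
extend-toℕ {n} u i with toℕ i <? n
... | yes i<n = cong u (fromℕ<-toℕ i i<n)
... | no  i≮n = ⊥-elim (i≮n (toℕ<n i))

ΣFin-cong : ∀ n {f g : Fin n → ℕ} → (∀ i → f i ≡ g i) → ΣFin n f ≡ ΣFin n g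
ΣFin-cong zero    f≗g = refl
ΣFin-cong (suc n) f≗g = cong₂ _+_ (f≗g zero) (ΣFin-cong n (f≗g ∘ suc))

ΣFin-zero : ∀ n {f : Fin n → ℕ} → (∀ i → f i ≡ 0) → ΣFin n f ≡ 0
ΣFin-zero zero    f≗0 = refl
ΣFin-zero (suc n) f≗0 = cong₂ _+_ (f≗0 zero) (ΣFin-zero n (f≗0 ∘ suc))

ΣFin-↑ : ∀ m n (f : Fin (m + n) → ℕ) →
         ΣFin (m + n) f ≡ ΣFin m (f ∘ (_↑ˡ n)) + ΣFin n (f ∘ (m ↑ʳ_))
ΣFin-↑ zero    n f = refl
ΣFin-↑ (suc m) n f = trans (cong (f zero +_) (ΣFin-↑ m n (f ∘ suc))) (sym (+-assoc (f zero) _ _))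

data Split (m n : ℕ) : Fin (m + n) → Set where
  left  : (x : Fin m) → Split m n (x ↑ˡ n)
  right : (y : Fin n) → Split m n (m ↑ʳ y)

split : ∀ m n (k : Fin (m + n)) → Split m n k
split m n k with splitAt m k in eq
... | inj₁ x = subst (Split m n) (splitAt⁻¹-↑ˡ eq) (left x)
... | inj₂ y = subst (Split m n) (splitAt⁻¹-↑ʳ eq) (right y)

module _ {m n : ℕ} {U₁ : Subset m} {U₂ : Subset n} where

  ∈-++ˡ⁺ : ∀ {x} → x ∈ U₁ → x ↑ˡ n ∈ U₁ ++ U₂
  ∈-++ˡ⁺ {x} x∈ = lookup⇒[]= _ _ (trans (lookup-++ˡ U₁ U₂ x) ([]=⇒lookup x∈))

  ∈-++ˡ⁻ : ∀ {x} → x ↑ˡ n ∈ U₁ ++ U₂ → x ∈ U₁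
  ∈-++ˡ⁻ {x} x∈ = lookup⇒[]= _ _ (trans (sym (lookup-++ˡ U₁ U₂ x)) ([]=⇒lookup x∈))

  ∈-++ʳ⁺ : ∀ {y} → y ∈ U₂ → m ↑ʳ y ∈ U₁ ++ U₂
  ∈-++ʳ⁺ {y} y∈ = lookup⇒[]= _ _ (trans (lookup-++ʳ U₁ U₂ y) ([]=⇒lookup y∈))

  ∈-++ʳ⁻ : ∀ {y} → m ↑ʳ y ∈ U₁ ++ U₂ → y ∈ U₂
  ∈-++ʳ⁻ {y} y∈ = lookup⇒[]= _ _ (trans (sym (lookup-++ʳ U₁ U₂ y)) ([]=⇒lookup y∈))

  Nonempty-++ : Nonempty (U₁ ++ U₂) ⇔ (Nonempty U₁ ⊎ Nonempty U₂)
  Nonempty-++ = mk⇔ to from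
    where
    to : Nonempty (U₁ ++ U₂) → Nonempty U₁ ⊎ Nonempty U₂
    to (k , k∈) with split m n k
    ... | left  x = inj₁ (x , ∈-++ˡ⁻ k∈)
    ... | right y = inj₂ (y , ∈-++ʳ⁻ k∈)

    from : Nonempty U₁ ⊎ Nonempty U₂ → Nonempty (U₁ ++ U₂)
    from (inj₁ (x , x∈)) = x ↑ˡ n , ∈-++ˡ⁺ x∈
    from (inj₂ (y , y∈)) = m ↑ʳ y , ∈-++ʳ⁺ y∈

Witness : ∀ {n} → Graph n → (Fin n → ℕ) → Subset n → Set
Witness G b U = ∃ λ i → i ∈ U × b i < dU G U (suc i)

module _ {p q : ℕ} (G₁ : Graph p) (G₂ : Graph q) where

  part-↑ˡ : ∀ x → part {p} {q} (suc (x ↑ˡ q)) ≡ g1 x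
  part-↑ˡ x = cong [ g1 , g2 ]′ (splitAt-↑ˡ p x q)

  part-↑ʳ : ∀ y → part {p} {q} (suc (p ↑ʳ y)) ≡ g2 y
  part-↑ʳ y = cong [ g1 , g2 ]′ (splitAt-↑ʳ p q y)

  dU-∪̇-↑ˡ : ∀ U₁ U₂ x → dU (G₁ ∪̇ G₂) (U₁ ++ U₂) (suc (x ↑ˡ q)) ≡ dU G₁ U₁ (suc x)
  dU-∪̇-↑ˡ U₁ U₂ x =
    trans (cong₂ _+_ (cong (λ π → wtPart G₁ G₂ π rt) (part-↑ˡ x))
                     (trans (ΣFin-↑ p q _) (cong₂ _+_ (ΣFin-cong p inG₁) (ΣFin-zero q inG₂))))
          (cong (Graph.wt G₁ (suc x) zero +_) (+-identityʳ _))
    where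
    inG₁ : ∀ x′ → (if lookup (U₁ ++ U₂) (x′ ↑ˡ q) then 0
                   else Graph.wt (G₁ ∪̇ G₂) (suc (x ↑ˡ q)) (suc (x′ ↑ˡ q)))
                ≡ (if lookup U₁ x′ then 0 else Graph.wt G₁ (suc x) (suc x′))
    inG₁ x′ = cong₂ (λ b w → if b then 0 else w) (lookup-++ˡ U₁ U₂ x′)
                    (cong₂ (wtPart G₁ G₂) (part-↑ˡ x) (part-↑ˡ x′))
    inG₂ : ∀ y → (if lookup (U₁ ++ U₂) (p ↑ʳ y) then 0
                  else Graph.wt (G₁ ∪̇ G₂) (suc (x ↑ˡ q)) (suc (p ↑ʳ y))) ≡ 0
    inG₂ y = trans (cong (λ w → if _ then 0 else w) (cong₂ (wtPart G₁ G₂) (part-↑ˡ x) (part-↑ʳ y)))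
                   (if-eta _)

  dU-∪̇-↑ʳ : ∀ U₁ U₂ y → dU (G₁ ∪̇ G₂) (U₁ ++ U₂) (suc (p ↑ʳ y)) ≡ dU G₂ U₂ (suc y)
  dU-∪̇-↑ʳ U₁ U₂ y =
    cong₂ _+_ (cong (λ π → wtPart G₁ G₂ π rt) (part-↑ʳ y))
              (trans (ΣFin-↑ p q _) (cong₂ _+_ (ΣFin-zero p inG₁) (ΣFin-cong q inG₂)))
    where
    inG₁ : ∀ x → (if lookup (U₁ ++ U₂) (x ↑ˡ q) then 0
                  else Graph.wt (G₁ ∪̇ G₂) (suc (p ↑ʳ y)) (suc (x ↑ˡ q))) ≡ 0
    inG₁ x = trans (cong (λ w → if _ then 0 else w) (cong₂ (wtPart G₁ G₂) (part-↑ʳ y) (part-↑ˡ x)))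
                   (if-eta _)
    inG₂ : ∀ y′ → (if lookup (U₁ ++ U₂) (p ↑ʳ y′) then 0
                   else Graph.wt (G₁ ∪̇ G₂) (suc (p ↑ʳ y)) (suc (p ↑ʳ y′)))
                ≡ (if lookup U₂ y′ then 0 else Graph.wt G₂ (suc y) (suc y′))
    inG₂ y′ = cong₂ (λ b w → if b then 0 else w) (lookup-++ʳ U₁ U₂ y′)
                    (cong₂ (wtPart G₁ G₂) (part-↑ʳ y) (part-↑ʳ y′))

  Witness-∪̇ : ∀ a b U₁ U₂ →
              Witness (G₁ ∪̇ G₂) (concatF a b) (U₁ ++ U₂) ⇔ (Witness G₁ a U₁ ⊎ Witness G₂ b U₂)
  Witness-∪̇ a b U₁ U₂ = mk⇔ to from
    where
    concatF-↑ˡ : ∀ x → concatF a b (x ↑ˡ q) ≡ a x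
    concatF-↑ˡ x = cong [ a , b ]′ (splitAt-↑ˡ p x q)

    concatF-↑ʳ : ∀ y → concatF a b (p ↑ʳ y) ≡ b y
    concatF-↑ʳ y = cong [ a , b ]′ (splitAt-↑ʳ p q y)

    to : Witness (G₁ ∪̇ G₂) (concatF a b) (U₁ ++ U₂) → Witness G₁ a U₁ ⊎ Witness G₂ b U₂
    to (k , k∈ , k<) with split p q k
    ... | left  x = inj₁ (x , ∈-++ˡ⁻ k∈ , subst₂ _<_ (concatF-↑ˡ x) (dU-∪̇-↑ˡ U₁ U₂ x) k<)
    ... | right y = inj₂ (y , ∈-++ʳ⁻ k∈ , subst₂ _<_ (concatF-↑ʳ y) (dU-∪̇-↑ʳ U₁ U₂ y) k<)

    from : Witness G₁ a U₁ ⊎ Witness G₂ b U₂ → Witness (G₁ ∪̇ G₂) (concatF a b) (U₁ ++ U₂)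
    from (inj₁ (x , x∈ , x<)) =
      x ↑ˡ q , ∈-++ˡ⁺ x∈ , subst₂ _<_ (sym (concatF-↑ˡ x)) (sym (dU-∪̇-↑ˡ U₁ U₂ x)) x<
    from (inj₂ (y , y∈ , y<)) =
      p ↑ʳ y , ∈-++ʳ⁺ y∈ , subst₂ _<_ (sym (concatF-↑ʳ y)) (sym (dU-∪̇-↑ʳ U₁ U₂ y)) y<

  IsGPF-∪̇ : ∀ a b → IsGPF (G₁ ∪̇ G₂) (concatF a b) ⇔ (IsGPF G₁ a × IsGPF G₂ b)
  IsGPF-∪̇ a b = mk⇔ (λ h → restrictˡ h , restrictʳ h) (λ (h₁ , h₂) → combine h₁ h₂)
    where
    restrictˡ : IsGPF (G₁ ∪̇ G₂) (concatF a b) → IsGPF G₁ a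
    restrictˡ h U₁ ne
      with Equivalence.to (Witness-∪̇ a b U₁ ⊥) (h (U₁ ++ ⊥) (Equivalence.from Nonempty-++ (inj₁ ne)))
    ... | inj₁ w             = w
    ... | inj₂ (_ , y∈⊥ , _) = ⊥-elim (∉⊥ y∈⊥)

    restrictʳ : IsGPF (G₁ ∪̇ G₂) (concatF a b) → IsGPF G₂ b
    restrictʳ h U₂ ne
      with Equivalence.to (Witness-∪̇ a b ⊥ U₂) (h (⊥ ++ U₂) (Equivalence.from Nonempty-++ (inj₂ ne)))
    ... | inj₁ (_ , x∈⊥ , _) = ⊥-elim (∉⊥ x∈⊥)
    ... | inj₂ w             = w

    combine : IsGPF G₁ a → IsGPF G₂ b → IsGPF (G₁ ∪̇ G₂) (concatF a b)
    combine h₁ h₂ U ne with Vec.splitAt p U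
    ... | U₁ , U₂ , refl = Equivalence.from (Witness-∪̇ a b U₁ U₂)
                             (Sum.map (h₁ U₁) (h₂ U₂) (Equivalence.to Nonempty-++ ne))

theorem4p1 : (p q : ℕ) → 1 ≤ p → 1 ≤ q →
    (u : Fin p → ℕ) → (v : Fin q → ℕ) →
    AdmissibleForm u → AdmissibleForm v →
    (G₁ : Graph p) → (G₂ : Graph q) →
    (∀ (a : Fin p → ℕ) → IsUPF u a ⇔ IsGPF G₁ a) →
    (∀ (b : Fin q → ℕ) → IsUPF v b ⇔ IsGPF G₂ b) →
    ∀ (a : Fin p → ℕ) (b : Fin q → ℕ) →
      IsPF2 (λ i j → extend u i) (λ i j → extend v j) a b
        ⇔ IsGPF (G₁ ∪̇ G₂) (concatF a b)
theorem4p1 p q _ _ u v _ _ G₁ G₂ u-PF≡G₁-PF v-PF≡G₂-PF a b = begin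
  IsPF2 (λ i _ → extend u i) (λ _ j → extend v j) a b
    ∼⟨ IsPF2-separable (extend u) (extend v) a b ⟩
  (IsUPF (extend u ∘ toℕ) a × IsUPF (extend v ∘ toℕ) b)
    ∼⟨ (IsUPF-cong (extend-toℕ u) a ×-⇔ IsUPF-cong (extend-toℕ v) b) ⟩
  (IsUPF u a × IsUPF v b)
    ∼⟨ (u-PF≡G₁-PF a ×-⇔ v-PF≡G₂-PF b) ⟩
  (IsGPF G₁ a × IsGPF G₂ b)
    ∼⟨ ⇔.sym (IsGPF-∪̇ G₁ G₂ a b) ⟩
  IsGPF (G₁ ∪̇ G₂) (concatF a b)
    ∎
  where open EquationalReasoning
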